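{- In the coupling construction described in the context, for every stage $\tau\ge1$: if $\tau$ is regular, then $(\mathcal{Y}^{\downarrow})^{\le\tau}$ is a deterministic function of $(\mathcal{Z}^{\le\tau},\mathcal{W}^{\le\tau},\mathcal{V}^{\le\tau},(\mathcal{Y}^{\uparrow})^{\le\mu^{ -1}(\tau)})$; if $\tau$ is a milestone, then $(\mathcal{Y}^{\downarrow})^{\le\tau}$ is a deterministic function of $(\mathcal{Z}^{\le\tau},\mathcal{W}^{\le\tau},\mathcal{V}^{\le\tau},(\mathcal{Y}^{\uparrow})^{\le\mu^{ -1}(\tau-1)})$. In particular, $(\mathcal{Y}^{\downarrow})^{\le\tau}$ is independent of $(\mathcal{Z}^{>\tau},\mathcal{W}^{>\tau},\mathcal{V}^{>\tau},(\mathcal{Y}^{\uparrow})^{>\mu^{ -1}(\tau)})$ for every regular stage $\tau$, and of $(\mathcal{Z}^{>\tau},\mathcal{W}^{>\tau},\mathcal{V}^{>\tau},(\mathcal{Y}^{\uparrow})^{>\mu^{ -1}(\tau-1)})$ for every milestone $\tau$.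
   Context: Let $\epsilon\in(0,\frac14)$ with $\frac1\epsilon$ an integer, $n\ge1$, and for each $i\in[n]$ let $p_i\in[\frac{\epsilon}{n^2},1-\frac{\epsilon}{n}]$. With $\delta=\frac{\epsilon^2}{16}$, $U(\cdot)$ rounding up and $D(\cdot)$ rounding down to the nearest integer power of $1+\delta$: if $p_i\le\frac\epsilon4$, $p_i^{\uparrow}=U(p_i)$, $p_i^{\downarrow}=U(p_i)/(1+\delta)$; if $p_i>\frac\epsilon4$, $p_i^{\uparrow}=1-D(1-p_i)$, $p_i^{\downarrow}=1-(1+\delta)D(1-p_i)$. Fix $\gamma\in\{1,\dots,\frac1\epsilon\}$. Milestones: $t_0=0$ and $t_k=\frac{k-1}{\epsilon}+\gamma$ for $k\ge1$; $\mathcal{M}_\gamma=\{t_1,t_2,\dots\}$; stages in $\mathbb{N}\setminus\mathcal{M}_\gamma$ are regular. $\mu:\mathbb{N}\to\mathbb{N}\setminus\mathcal{M}_\gamma$ maps $t$ to the $t$-th regular stage (a bijection). Coupling: all the following are mutually independent Bernoulli variables: $Y^{\uparrow}_{i,t}$ ($i\in[n]$, $t\ge1$) with mean $p_i^{\uparrow}$; $Z_{i,\tau}$ ($\tau$ regular) with mean $p_i^{\downarrow}/p_i^{\uparrow}$; $W_{i,\tau}$ ($\tau=t_k$ a milestone) with mean $\frac{p_i^{\downarrow}-\xi_{i,\tau}}{1-\xi_{i,\tau}}$ where $\xi_{i,\tau}=1-\big(\frac{1-p_i^{\uparrow}}{1-p_i^{\downarrow}}\big)^{t_k-t_{k-1}-1}$;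 $V_{i,\tau}$ ($\tau$ a milestone) with mean $p_i^{\downarrow}$. Define $Y^{\downarrow}_{i,\tau}=Y^{\uparrow}_{i,\mu^{ -1}(\tau)}Z_{i,\tau}$ for regular $\tau$, and for $\tau=t_k$ a milestone, $Y^{\downarrow}_{i,\tau}=1-(1-W_{i,\tau})\prod_{s=t_{k-1}+1}^{t_k-1}(1-Y^{\uparrow}_{i,\mu^{ -1}(s)})$ if $Y^{\downarrow}_{i,1}=\dots=Y^{\downarrow}_{i,\tau-1}=0$, and $Y^{\downarrow}_{i,\tau}=V_{i,\tau}$ otherwise. Notation: for a collection $\mathcal{P}$ indexed by $(i,t)$, $\mathcal{P}^{\le t}$ is the subcollection with stage index $\le t$ (over all $i$), and $\mathcal{P}^{>t}$ those with stage index $>t$; $\mathcal{Y}^{\uparrow},\mathcal{Y}^{\downarrow},\mathcal{Z},\mathcal{W},\mathcal{V}$ denote the respective collections; when $\tau-1=0$ the collection $(\mathcal{Y}^{\uparrow})^{\le\mu^{ -1}(\tau-1)}$ is empty. -}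

module Defs where

open import Data.Bool using (Bool; true; false; _∧_; _∨_; not; if_then_else_)
open import Data.Nat using (ℕ; zero; suc; _+_; _*_; _∸_; _≤_; _≡ᵇ_)
open import Data.Fin using (Fin)
open import Data.List using (List; map; upTo)
open import Data.Bool.ListAction using (any)
open import Data.Product using (∃-syntax; _×_)
open import Relation.Binary.PropositionalEquality using (_≡_)
open import Relation.Nullary using (¬_)

-- Parameters: m = 1/ε (a positive integer), γ ∈ {1,…,m}.
-- Stages are the positive integers 1,2,3,…
-- Milestones: t_k = (k-1)·m + γ for k ≥ 1, i.e. s = j·m + γ for some j ≥ 0.
-- t_0 = 0 is not a milestone.

Milestone : (m γ s : ℕ) → Set
Milestone m γ s = ∃[ j ] s ≡ j * m + γ

Regular : (m γ s : ℕ) → Set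
Regular m γ s = ¬ Milestone m γ s

-- Boolean test for being a milestone (bounded search: j ≤ s suffices when m ≥ 1)
isMilestone : (m γ s : ℕ) → Bool
isMilestone m γ s = any (λ j → (j * m + γ) ≡ᵇ s) (upTo (suc s))

-- μ⁻¹ : μ maps t ≥ 1 to the t-th regular stage, so for a stage s,
-- muInv s = number of regular stages in {1,…,s}.  On regular s this is μ⁻¹(s);
-- muInv 0 = 0 (empty prefix of 𝒴↑).
muInv : (m γ s : ℕ) → ℕ
muInv m γ zero = zero
muInv m γ (suc s) = if isMilestone m γ (suc s) then muInv m γ s else suc (muInv m γ s)

-- A sample point of the coupling: the values of the independent Bernoulli
-- variables Y↑_{i,t}, Z_{i,τ}, W_{i,τ}, V_{i,τ}.  (Z is only consulted at
-- regular stages, W and V only at milestones.)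
record Sample (n : ℕ) : Set where
  field
    yUp : Fin n → ℕ → Bool
    z   : Fin n → ℕ → Bool
    w   : Fin n → ℕ → Bool
    v   : Fin n → ℕ → Bool
open Sample public

anyBetween : (ℕ → Bool) → ℕ → ℕ → Bool
anyBetween f lo hi = any (λ d → f (suc (lo + d))) (upTo (hi ∸ suc lo))

mutual
  -- Y↓_{i,τ} (stage 0 is unused; set to false)
  yDown : (m γ : ℕ) {n : ℕ} → Sample n → Fin n → ℕ → Bool
  yDown m γ ω i zero = false
  yDown m γ ω i (suc s) =
    if isMilestone m γ (suc s)
    then (if allZero m γ ω i s
          -- 1 - (1 - W) ∏_{s' = t_{k-1}+1}^{t_k - 1} (1 - Y↑_{i,μ⁻¹(s')}), with t_{k-1} = t_k - m
          then w ω i (suc s) ∨ anyBetween (λ s' → yUp ω i (muInv m γ s')) (suc s ∸ m) (suc s)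
          else v ω i (suc s))
    else yUp ω i (muInv m γ (suc s)) ∧ z ω i (suc s)

  allZero : (m γ : ℕ) {n : ℕ} → Sample n → Fin n → ℕ → Bool
  allZero m γ ω i zero = true
  allZero m γ ω i (suc k) = allZero m γ ω i k ∧ not (yDown m γ ω i (suc k))

AgreeUpTo : (m γ : ℕ) {n : ℕ} → Sample n → Sample n → (τ b : ℕ) → Set
AgreeUpTo m γ {n} ω ω' τ b =
  (∀ (i : Fin n) s → 1 ≤ s → s ≤ τ → Regular m γ s → z ω i s ≡ z ω' i s) ×
  ((∀ (i : Fin n) s → 1 ≤ s → s ≤ τ → Milestone m γ s → w ω i s ≡ w ω' i s) ×
  ((∀ (i : Fin n) s → 1 ≤ s → s ≤ τ → Milestone m γ s → v ω i s ≡ v ω' i s) ×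
   (∀ (i : Fin n) t → 1 ≤ t → t ≤ b → yUp ω i t ≡ yUp ω' i t)))

SameYDownUpTo : (m γ : ℕ) {n : ℕ} → Sample n → Sample n → ℕ → Set
SameYDownUpTo m γ {n} ω ω' τ =
  ∀ (i : Fin n) t → 1 ≤ t → t ≤ τ → yDown m γ ω i t ≡ yDown m γ ω' i t

{-# OPTIONS --safe #-}
module Submission where

open import Defs
open import Data.Bool using (Bool; true; false; _∧_; not; T)
open import Data.Bool.ListAction using (or)
open import Data.Fin using (Fin)
open import Data.List using (upTo)
open import Data.List.Membership.Propositional using (lose)
open import Data.List.Membership.Propositional.Properties using (∈-upTo⁺)
open import Data.List.Properties using (map-cong-local)
open import Data.List.Relation.Unary.All.Properties using (applyUpTo⁺₁)
open import Data.List.Relation.Unary.Any using (satisfied)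
open import Data.List.Relation.Unary.Any.Properties using (any⁺; any⁻)
open import Data.Nat using (ℕ; zero; suc; _+_; _*_; _∸_; _≤_; _<_; _≤′_; ≤′-refl; ≤′-step; z≤n; s≤s; s≤s⁻¹)
open import Data.Nat.Properties
open import Data.Product using (_×_; _,_; ∃-syntax)
open import Function using (_∘_)
open import Relation.Binary.PropositionalEquality using (_≡_; refl; sym; cong; cong₂; subst)
open import Relation.Nullary.Negation using (contradiction)
open import Relation.Nullary.Reflects using (Reflects; ofʸ; ofⁿ; fromEquivalence)

-- Y↓ at a regular stage s reads Z at s and Y↑ at μ⁻¹(s); at a milestone t_k it reads W and V
-- at t_k, the earlier Y↓ (through the test "all earlier Y↓ vanish"), and Y↑ at μ⁻¹(s) for
-- t_{k-1} < s < t_k.  Two milestones are at least m apart, so all those s are regular, and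
-- induction on the stage shows that Y↓ up to τ depends only on Z, W, V up to τ and on Y↑ at
-- μ⁻¹ of the regular stages up to τ.  As μ⁻¹ is monotone, these are Y↑ up to μ⁻¹(τ), and for
-- a milestone τ, which is itself not regular, Y↑ up to μ⁻¹(τ − 1).

m<o∸n⇒n+m<o : ∀ m n o → m < o ∸ n → n + m < o
m<o∸n⇒n+m<o m zero    o       m<o   = m<o
m<o∸n⇒n+m<o m (suc n) (suc o) m<o∸n = s≤s (m<o∸n⇒n+m<o m n o m<o∸n)

anyBetween-cong : ∀ (f g : ℕ → Bool) lo hi → (∀ s → lo < s → s < hi → f s ≡ g s) →
                  anyBetween f lo hi ≡ anyBetween g lo hi
anyBetween-cong f g lo hi f≡g = cong or (map-cong-local (applyUpTo⁺₁ _ (hi ∸ suc lo) inside))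
  where
  inside : ∀ {d} → d < hi ∸ suc lo → f (suc (lo + d)) ≡ g (suc (lo + d))
  inside {d} d<len = f≡g (suc (lo + d)) (s≤s (m≤m+n lo d)) (m<o∸n⇒n+m<o d (suc lo) hi d<len)

Milestone⇒index≤ : ∀ {m γ s} → Milestone m γ s → ∃[ j ] j ≤ s × j * m + γ ≡ s
Milestone⇒index≤ {zero}  {γ} (j , refl) = 0 , z≤n , cong (_+ γ) (sym (*-zeroʳ j))
Milestone⇒index≤ {suc m} {γ} (j , refl) = j , ≤-trans (m≤m*n j (suc m)) (m≤m+n _ γ) , refl

isMilestone-reflects : ∀ m γ s → Reflects (Milestone m γ s) (isMilestone m γ s)
isMilestone-reflects m γ s = fromEquivalence sound complete
  where
  sound : T (isMilestone m γ s) → Milestone m γ s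
  sound hit with j , j≡ ← satisfied (any⁻ _ (upTo (suc s)) hit) = j , sym (≡ᵇ⇒≡ _ s j≡)
  complete : Milestone m γ s → T (isMilestone m γ s)
  complete M with j , j≤s , j≡ ← Milestone⇒index≤ M =
    any⁺ _ (lose (∈-upTo⁺ (s≤s j≤s)) (≡⇒≡ᵇ _ s j≡))

milestone-gap : ∀ {m γ s t} → Milestone m γ s → Milestone m γ t → s < t → s + m ≤ t
milestone-gap {m} {γ} (i , refl) (j , refl) s<t = begin
  i * m + γ + m   ≡⟨ +-comm (i * m + γ) m ⟩
  m + (i * m + γ) ≡⟨ +-assoc m (i * m) γ ⟨
  suc i * m + γ   ≤⟨ +-monoˡ-≤ γ (*-monoˡ-≤ m i<j) ⟩
  j * m + γ       ∎
  where
  open ≤-Reasoning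
  i<j : i < j
  i<j = *-cancelʳ-< m i j (+-cancelʳ-< γ (i * m) (j * m) s<t)

Regular-inside-gap : ∀ {m γ s t} → Milestone m γ t → t ∸ m < s → s < t → Regular m γ s
Regular-inside-gap {s = s} Mt t∸m<s s<t Ms = <⇒≱ t∸m<s (m+n≤o⇒m≤o∸n s (milestone-gap Ms Mt s<t))

muInv-regular : ∀ {m γ s} → Regular m γ (suc s) → muInv m γ (suc s) ≡ suc (muInv m γ s)
muInv-regular {m} {γ} {s} R with isMilestone m γ (suc s) | isMilestone-reflects m γ (suc s)
... | true  | ofʸ M = contradiction M R
... | false | _     = refl

muInv-≤-suc : ∀ m γ s → muInv m γ s ≤ muInv m γ (suc s)
muInv-≤-suc m γ s with isMilestone m γ (suc s)
... | true  = ≤-refl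
... | false = n≤1+n _

muInv-mono′ : ∀ m γ {s t} → s ≤′ t → muInv m γ s ≤ muInv m γ t
muInv-mono′ m γ ≤′-refl       = ≤-refl
muInv-mono′ m γ (≤′-step s≤t) = ≤-trans (muInv-mono′ m γ s≤t) (muInv-≤-suc m γ _)

muInv-mono : ∀ m γ {s t} → s ≤ t → muInv m γ s ≤ muInv m γ t
muInv-mono m γ = muInv-mono′ m γ ∘ ≤⇒≤′

module _ {n m γ : ℕ} {ω ω' : Sample n} {τ : ℕ}
  (z≡ : ∀ (i : Fin n) s → 1 ≤ s → s ≤ τ → Regular m γ s → z ω i s ≡ z ω' i s)
  (w≡ : ∀ (i : Fin n) s → 1 ≤ s → s ≤ τ → Milestone m γ s → w ω i s ≡ w ω' i s)
  (v≡ : ∀ (i : Fin n) s → 1 ≤ s → s ≤ τ → Milestone m γ s → v ω i s ≡ v ω' i s)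
  (yUp∘muInv≡ : ∀ (i : Fin n) s → suc s ≤ τ → Regular m γ (suc s) →
                yUp ω i (muInv m γ (suc s)) ≡ yUp ω' i (muInv m γ (suc s)))
  where

  window-≡ : ∀ i t → t ≤ τ → Milestone m γ t →
             anyBetween (λ s → yUp ω i (muInv m γ s)) (t ∸ m) t ≡
             anyBetween (λ s → yUp ω' i (muInv m γ s)) (t ∸ m) t
  window-≡ i t t≤τ Mt =
    anyBetween-cong (yUp ω i ∘ muInv m γ) (yUp ω' i ∘ muInv m γ) (t ∸ m) t λ where
      zero    ()      _
      (suc s) t∸m<s s<t → yUp∘muInv≡ i s (≤-trans (<⇒≤ s<t) t≤τ) (Regular-inside-gap Mt t∸m<s s<t)

  yDown-suc-≡ : ∀ i s → suc s ≤ τ → allZero m γ ω i s ≡ allZero m γ ω' i s →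
                yDown m γ ω i (suc s) ≡ yDown m γ ω' i (suc s)
  yDown-suc-≡ i s s<τ allZero≡ with isMilestone m γ (suc s) | isMilestone-reflects m γ (suc s)
  ... | true  | ofʸ M rewrite allZero≡ | w≡ i (suc s) (s≤s z≤n) s<τ M | v≡ i (suc s) (s≤s z≤n) s<τ M
                            | window-≡ i (suc s) s<τ M = refl
  ... | false | ofⁿ R = cong₂ _∧_ yUp≡ (z≡ i (suc s) (s≤s z≤n) s<τ R)
    where
    yUp≡ : yUp ω i (suc (muInv m γ s)) ≡ yUp ω' i (suc (muInv m γ s))
    yUp≡ = subst (λ k → yUp ω i k ≡ yUp ω' i k) (muInv-regular R) (yUp∘muInv≡ i s s<τ R)

  allZero-≡ : ∀ i s → s ≤ τ → allZero m γ ω i s ≡ allZero m γ ω' i s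
  allZero-≡ i zero    _   = refl
  allZero-≡ i (suc s) s<τ = cong₂ (λ a y → a ∧ not y) allZero≡ (yDown-suc-≡ i s s<τ allZero≡)
    where
    allZero≡ : allZero m γ ω i s ≡ allZero m γ ω' i s
    allZero≡ = allZero-≡ i s (<⇒≤ s<τ)

  yDown-≡ : SameYDownUpTo m γ ω ω' τ
  yDown-≡ i (suc s) _ s<τ = yDown-suc-≡ i s s<τ (allZero-≡ i s (<⇒≤ s<τ))

yDown-determined : ∀ {n m γ} {ω ω' : Sample n} {τ b} → AgreeUpTo m γ ω ω' τ b →
                   (∀ s → s ≤ τ → Regular m γ s → muInv m γ s ≤ b) → SameYDownUpTo m γ ω ω' τ
yDown-determined {n} {m} {γ} {ω} {ω'} {τ} (z≡ , w≡ , v≡ , yUp≡) muInv≤b =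
  yDown-≡ z≡ w≡ v≡ yUp∘muInv≡
  where
  yUp∘muInv≡ : ∀ (i : Fin n) s → suc s ≤ τ → Regular m γ (suc s) →
               yUp ω i (muInv m γ (suc s)) ≡ yUp ω' i (muInv m γ (suc s))
  yUp∘muInv≡ i s s<τ R =
    yUp≡ i _ (subst (1 ≤_) (sym (muInv-regular R)) (s≤s z≤n)) (muInv≤b (suc s) s<τ R)

lemma6 : (n m γ : ℕ) → 1 ≤ n → 4 < m → 1 ≤ γ → γ ≤ m →
    (τ : ℕ) → 1 ≤ τ →
    ((Regular m γ τ → ∀ (ω ω' : Sample n) →
        AgreeUpTo m γ ω ω' τ (muInv m γ τ) → SameYDownUpTo m γ ω ω' τ)
     ×
     (Milestone m γ τ → ∀ (ω ω' : Sample n) →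
        AgreeUpTo m γ ω ω' τ (muInv m γ (τ ∸ 1)) → SameYDownUpTo m γ ω ω' τ))
lemma6 _ m γ _ _ _ _ (suc t) _ =
  (λ _ _ _ agree → yDown-determined agree λ s s≤τ _ → muInv-mono m γ s≤τ) ,
  (λ M _ _ agree → yDown-determined agree λ s s≤τ R →
     muInv-mono m γ (s≤s⁻¹ (≤∧≢⇒< s≤τ λ { refl → R M })))
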